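{- For formulas $\alpha_1,\dots,\alpha_n,\beta_1,\dots,\beta_m$, the sequent $\alpha_1,\dots,\alpha_n\Rightarrow\beta_1,\dots,\beta_m$ is valid if and only if $\bigwedge_{i=1}^n\alpha_i\models_{\mathbf{Six}}\bigvee_{j=1}^m\beta_j$ (with the empty conjunction read as $\top$ and the empty disjunction as $\bot$).
   Context: $\mathbb{S}_6$ is the involutive Stone algebra with universe $\{0,\tfrac13,N,B,\tfrac23,1\}$, lattice order $0<\tfrac13<N<\tfrac23<1$, $\tfrac13<B<\tfrac23$, $N,B$ incomparable; $\neg$ swaps $0\leftrightarrow1$, $\tfrac13\leftrightarrow\tfrac23$, fixes $N,B$; $\nabla0=0$, $\nabla x=1$ for $x\ne0$. An involutive Stone algebra is a De Morgan algebra (bounded distributive lattice with $\neg\neg x=x$, $\neg(x\wedge y)=\neg x\vee\neg y$) with unary $\nabla$ satisfying $\nabla0=0$, $a\wedge\nabla a=a$, $\nabla(a\wedge b)=\nabla a\wedge\nabla b$, $\neg\nabla a\wedge\nabla a=0$; the class is $\mathbf S$. $Fm$: formulas over a denumerable set of variables built from $\wedge,\vee,\neg,\nabla,\bot,\top$; homomorphisms send $\bot\mapsto0,\top\mapsto1$. $\alpha\models_{\mathbf{Six}}\beta$ iff for every $A\in\mathbf S$, homomorphism $v:\mathfrak{Fm}\to A$ and $a\in A$, $v(\alpha)\ge a$ implies $v(\beta)\ge a$. A sequent $\alpha_1,\dots,\alpha_n\Rightarrow\beta_1,\dots,\beta_m$ is valid iff $h(\bigwedge_{i}\alpha_i)\le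 h(\bigvee_j\beta_j)$ for every homomorphism $h:\mathfrak{Fm}\to\mathbb{S}_6$, with empty conjunction $\top$ and empty disjunction $\bot$. -}

module Defs where

open import Level using (Level; _⊔_) renaming (suc to lsuc)
open import Data.Nat using (ℕ)
open import Data.List using (List; []; _∷_)
open import Relation.Binary.PropositionalEquality using (_≡_)

data Fm : Set where
  var  : ℕ → Fm
  _∧ᶠ_ : Fm → Fm → Fm
  _∨ᶠ_ : Fm → Fm → Fm
  ¬ᶠ_  : Fm → Fm
  ∇ᶠ_  : Fm → Fm
  ⊥ᶠ   : Fm
  ⊤ᶠ   : Fm

⋀ : List Fm → Fm
⋀ []           = ⊤ᶠ
⋀ (a ∷ [])     = a
⋀ (a ∷ b ∷ as) = a ∧ᶠ ⋀ (b ∷ as)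

⋁ : List Fm → Fm
⋁ []           = ⊥ᶠ
⋁ (a ∷ [])     = a
⋁ (a ∷ b ∷ as) = a ∨ᶠ ⋁ (b ∷ as)

record RawISA (ℓ : Level) : Set (lsuc ℓ) where
  field
    Carrier : Set ℓ
    _⊓_ _⊔'_ : Carrier → Carrier → Carrier
    ∼_ ▽_    : Carrier → Carrier
    𝟘 𝟙      : Carrier

  _≤_ : Carrier → Carrier → Set ℓ
  a ≤ b = a ⊓ b ≡ a

-- The homomorphism 𝔉𝔪 → A determined by a valuation of the variables
-- (every homomorphism from the formula algebra is of this form).
-- eval A φ v : the homomorphism 𝔉𝔪 → A extending the valuation v
-- (every homomorphism from the formula algebra is of this form).
module _ {ℓ} (A : RawISA ℓ) where
  open RawISA A
  eval : Fm → (ℕ → Carrier) → Carrier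
  eval (var x)   v = v x
  eval (a ∧ᶠ b)  v = eval a v ⊓ eval b v
  eval (a ∨ᶠ b)  v = eval a v ⊔' eval b v
  eval (¬ᶠ a)    v = ∼ eval a v
  eval (∇ᶠ a)    v = ▽ eval a v
  eval ⊥ᶠ        v = 𝟘
  eval ⊤ᶠ        v = 𝟙

record IsISA {ℓ} (A : RawISA ℓ) : Set ℓ where
  open RawISA A
  field
    ⊓-assoc  : ∀ a b c → (a ⊓ b) ⊓ c ≡ a ⊓ (b ⊓ c)
    ⊔-assoc  : ∀ a b c → (a ⊔' b) ⊔' c ≡ a ⊔' (b ⊔' c)
    ⊓-comm   : ∀ a b → a ⊓ b ≡ b ⊓ a
    ⊔-comm   : ∀ a b → a ⊔' b ≡ b ⊔' a
    ⊓-absorb : ∀ a b → a ⊓ (a ⊔' b) ≡ a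
    ⊔-absorb : ∀ a b → a ⊔' (a ⊓ b) ≡ a
    distrib  : ∀ a b c → a ⊓ (b ⊔' c) ≡ (a ⊓ b) ⊔' (a ⊓ c)
    𝟘-bot    : ∀ a → 𝟘 ⊓ a ≡ 𝟘
    𝟙-top    : ∀ a → a ⊓ 𝟙 ≡ a
    ∼∼       : ∀ a → ∼ (∼ a) ≡ a
    deMorgan : ∀ a b → ∼ (a ⊓ b) ≡ (∼ a) ⊔' (∼ b)
    ▽𝟘       : ▽ 𝟘 ≡ 𝟘
    ▽-incr   : ∀ a → a ⊓ (▽ a) ≡ a
    ▽-⊓      : ∀ a b → ▽ (a ⊓ b) ≡ (▽ a) ⊓ (▽ b)
    ▽-compl  : ∀ a → (∼ (▽ a)) ⊓ (▽ a) ≡ 𝟘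

record ISA (ℓ : Level) : Set (lsuc ℓ) where
  field
    raw   : RawISA ℓ
    isISA : IsISA raw
  open RawISA raw public

_⊨Six[_]_ : Fm → (ℓ : Level) → Fm → Set (lsuc ℓ)
α ⊨Six[ ℓ ] β =
  (A : ISA ℓ) (v : ℕ → ISA.Carrier A) (a : ISA.Carrier A) →
  ISA._≤_ A a (eval (ISA.raw A) α v) → ISA._≤_ A a (eval (ISA.raw A) β v)

-- The six-element algebra 𝕊₆ : 0 < 1/3 < N,B < 2/3 < 1

data S6 : Set where
  s0 s⅓ sN sB s⅔ s1 : S6

_⊓₆_ : S6 → S6 → S6
s0 ⊓₆ _  = s0
_  ⊓₆ s0 = s0
s1 ⊓₆ y  = y
x  ⊓₆ s1 = x
s⅓ ⊓₆ _  = s⅓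
_  ⊓₆ s⅓ = s⅓
s⅔ ⊓₆ y  = y
x  ⊓₆ s⅔ = x
sN ⊓₆ sN = sN
sB ⊓₆ sB = sB
sN ⊓₆ sB = s⅓
sB ⊓₆ sN = s⅓

_⊔₆_ : S6 → S6 → S6
s1 ⊔₆ _  = s1
_  ⊔₆ s1 = s1
s0 ⊔₆ y  = y
x  ⊔₆ s0 = x
s⅔ ⊔₆ _  = s⅔
_  ⊔₆ s⅔ = s⅔
s⅓ ⊔₆ y  = y
x  ⊔₆ s⅓ = x
sN ⊔₆ sN = sN
sB ⊔₆ sB = sB
sN ⊔₆ sB = s⅔
sB ⊔₆ sN = s⅔

¬₆ : S6 → S6
¬₆ s0 = s1
¬₆ s⅓ = s⅔
¬₆ sN = sN
¬₆ sB = sB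
¬₆ s⅔ = s⅓
¬₆ s1 = s0

∇₆ : S6 → S6
∇₆ s0 = s0
∇₆ _  = s1

𝕊₆ : RawISA Level.zero
𝕊₆ = record
  { Carrier = S6 ; _⊓_ = _⊓₆_ ; _⊔'_ = _⊔₆_ ; ∼_ = ¬₆ ; ▽_ = ∇₆ ; 𝟘 = s0 ; 𝟙 = s1 }

ValidSeq : List Fm → List Fm → Set
ValidSeq Γ Δ =
  (v : ℕ → S6) → RawISA._≤_ 𝕊₆ (eval 𝕊₆ (⋀ Γ) v) (eval 𝕊₆ (⋁ Δ) v)

{-# OPTIONS --safe #-}
-- One direction only specialises ⊨Six to 𝕊₆. For the other, normal forms reduce an
-- inequality α ≤ β to inequalities ⋀C ≤ ⋁D between a conjunction C and a disjunction D
-- of literals x, ¬x, ∇x, ¬∇x, ∇¬x, ¬∇¬x. If every variable has a value in 𝕊₆ sending its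
-- C-literals into the prime filter ↑N and its D-literals outside it, these values refute
-- ⋀C ≤ ⋁D in 𝕊₆. Otherwise some variable x has no such value, and ⋀C ≤ ⋁D holds in every
-- involutive Stone algebra: the complemented elements ∇x and ∇¬x cut the algebra into the
-- regions ¬∇x, ¬∇¬x and ∇x ∧ ∇¬x, where x behaves like 0, like 1, and like an element of
-- the De Morgan algebra {⅓, N, B, ⅔}, and the failure of the corresponding values of 𝕊₆
-- closes each region; in the last one it forces C and D to share a literal x or ¬x.
module Submission where

open import Defs
open import Level using (Level; Lift; lift; lower; _⊔_)
open import Data.List using (List; []; _∷_; _++_; [_]; map; filter; cartesianProductWith)
open import Function.Bundles using (_⇔_; mk⇔)
open import Algebra.Lattice.Structures using () renaming (IsLattice to IsAlgLattice)
import Algebra.Lattice.Properties.Lattice as AlgLatticeProperties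
open import Data.Empty using (⊥-elim)
open import Data.Fin using (Fin; #_)
import Data.Fin.Properties as Fin
open import Data.List.Membership.Propositional using (_∈_; find)
open import Data.List.Membership.Propositional.Properties
  using (∈-map⁺; ∈-map⁻; ∈-filter⁺; ∈-filter⁻; ∈-++⁺ˡ; ∈-++⁺ʳ)
open import Data.List.Properties using (map-++)
open import Data.List.Relation.Unary.All as All using (All; []; _∷_; all?)
open import Data.List.Relation.Unary.All.Properties using (¬All⇒Any¬)
open import Data.List.Relation.Unary.Any using (here; there)
open import Data.Nat using (ℕ; _≟_)
open import Data.Product using (∃; _×_; _,_; proj₁; proj₂; map₁)
open import Data.Sum using (_⊎_; inj₁; inj₂)
open import Data.Vec using (Vec; []; _∷_; lookup)
open import Function.Base using (_∘_)
open import Relation.Binary.Definitions using (DecidableEquality)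
open import Relation.Binary.Lattice using (Lattice)
import Relation.Binary.Lattice.Properties.JoinSemilattice as JoinSemilatticeProperties
import Relation.Binary.Lattice.Properties.MeetSemilattice as MeetSemilatticeProperties
open import Relation.Binary.PropositionalEquality
  using (_≡_; refl; sym; trans; cong; cong₂; subst; subst₂; isEquivalence)
import Relation.Binary.Reasoning.PartialOrder as PartialOrderReasoning
open import Relation.Nullary using (¬_; Dec; yes; no; ¬?; contradiction)
open import Relation.Nullary.Decidable using (map′; from-yes; _×-dec_; _→-dec_)
open import Relation.Unary using (Pred; Decidable)

S6-elements : Vec S6 6
S6-elements = s0 ∷ s⅓ ∷ sN ∷ sB ∷ s⅔ ∷ s1 ∷ []

S6-index : S6 → Fin 6
S6-index s0 = # 0
S6-index s⅓ = # 1
S6-index sN = # 2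
S6-index sB = # 3
S6-index s⅔ = # 4
S6-index s1 = # 5

lookup-S6-index : ∀ x → lookup S6-elements (S6-index x) ≡ x
lookup-S6-index s0 = refl
lookup-S6-index s⅓ = refl
lookup-S6-index sN = refl
lookup-S6-index sB = refl
lookup-S6-index s⅔ = refl
lookup-S6-index s1 = refl

infix 4 _≟₆_
_≟₆_ : DecidableEquality S6
x ≟₆ y = map′ index-injective (cong S6-index) (S6-index x Fin.≟ S6-index y)
  where
  index-injective : S6-index x ≡ S6-index y → x ≡ y
  index-injective e = trans (sym (lookup-S6-index x))
    (trans (cong (lookup S6-elements) e) (lookup-S6-index y))

all₆? : ∀ {p} {P : Pred S6 p} → Decidable P → Dec (∀ x → P x)
all₆? {P = P} P? = map′ (λ h x → subst P (lookup-S6-index x) (h (S6-index x)))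
  (λ h i → h (lookup S6-elements i)) (Fin.all? (P? ∘ lookup S6-elements))

any₆? : ∀ {p} {P : Pred S6 p} → Decidable P → Dec (∃ P)
any₆? {P = P} P? = map′ (λ (i , p) → lookup S6-elements i , p)
  (λ (x , p) → S6-index x , subst P (sym (lookup-S6-index x)) p)
  (Fin.any? (P? ∘ lookup S6-elements))

𝕊₆-isISA : IsISA 𝕊₆
𝕊₆-isISA = record
  { ⊓-assoc  = from-yes (all₆? λ a → all₆? λ b → all₆? λ c →
                 (a ⊓₆ b) ⊓₆ c ≟₆ a ⊓₆ (b ⊓₆ c))
  ; ⊔-assoc  = from-yes (all₆? λ a → all₆? λ b → all₆? λ c →
                 (a ⊔₆ b) ⊔₆ c ≟₆ a ⊔₆ (b ⊔₆ c))
  ; ⊓-comm   = from-yes (all₆? λ a → all₆? λ b → a ⊓₆ b ≟₆ b ⊓₆ a)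
  ; ⊔-comm   = from-yes (all₆? λ a → all₆? λ b → a ⊔₆ b ≟₆ b ⊔₆ a)
  ; ⊓-absorb = from-yes (all₆? λ a → all₆? λ b → a ⊓₆ (a ⊔₆ b) ≟₆ a)
  ; ⊔-absorb = from-yes (all₆? λ a → all₆? λ b → a ⊔₆ (a ⊓₆ b) ≟₆ a)
  ; distrib  = from-yes (all₆? λ a → all₆? λ b → all₆? λ c →
                 a ⊓₆ (b ⊔₆ c) ≟₆ (a ⊓₆ b) ⊔₆ (a ⊓₆ c))
  ; 𝟘-bot    = from-yes (all₆? λ a → s0 ⊓₆ a ≟₆ s0)
  ; 𝟙-top    = from-yes (all₆? λ a → a ⊓₆ s1 ≟₆ a)
  ; ∼∼       = from-yes (all₆? λ a → ¬₆ (¬₆ a) ≟₆ a)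
  ; deMorgan = from-yes (all₆? λ a → all₆? λ b → ¬₆ (a ⊓₆ b) ≟₆ (¬₆ a) ⊔₆ (¬₆ b))
  ; ▽𝟘       = refl
  ; ▽-incr   = from-yes (all₆? λ a → a ⊓₆ (∇₆ a) ≟₆ a)
  ; ▽-⊓      = from-yes (all₆? λ a → all₆? λ b → ∇₆ (a ⊓₆ b) ≟₆ (∇₆ a) ⊓₆ (∇₆ b))
  ; ▽-compl  = from-yes (all₆? λ a → (¬₆ (∇₆ a)) ⊓₆ (∇₆ a) ≟₆ s0)
  }

𝕊₆-ISA : ISA Level.zero
𝕊₆-ISA = record { raw = 𝕊₆ ; isISA = 𝕊₆-isISA }

module _ {a : Level} (ℓ : Level) where

  liftRaw : RawISA a → RawISA (a ⊔ ℓ)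
  liftRaw A = record
    { Carrier = Lift ℓ Carrier
    ; _⊓_ = λ x y → lift (lower x ⊓ lower y)
    ; _⊔'_ = λ x y → lift (lower x ⊔' lower y)
    ; ∼_ = λ x → lift (∼ lower x)
    ; ▽_ = λ x → lift (▽ lower x)
    ; 𝟘 = lift 𝟘
    ; 𝟙 = lift 𝟙
    }
    where open RawISA A

  liftISA : ISA a → ISA (a ⊔ ℓ)
  liftISA A = record
    { raw = liftRaw raw
    ; isISA = record
      { ⊓-assoc  = λ x y z → cong lift (⊓-assoc (lower x) (lower y) (lower z))
      ; ⊔-assoc  = λ x y z → cong lift (⊔-assoc (lower x) (lower y) (lower z))
      ; ⊓-comm   = λ x y → cong lift (⊓-comm (lower x) (lower y))
      ; ⊔-comm   = λ x y → cong lift (⊔-comm (lower x) (lower y))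
      ; ⊓-absorb = λ x y → cong lift (⊓-absorb (lower x) (lower y))
      ; ⊔-absorb = λ x y → cong lift (⊔-absorb (lower x) (lower y))
      ; distrib  = λ x y z → cong lift (distrib (lower x) (lower y) (lower z))
      ; 𝟘-bot    = λ x → cong lift (𝟘-bot (lower x))
      ; 𝟙-top    = λ x → cong lift (𝟙-top (lower x))
      ; ∼∼       = λ x → cong lift (∼∼ (lower x))
      ; deMorgan = λ x y → cong lift (deMorgan (lower x) (lower y))
      ; ▽𝟘       = cong lift ▽𝟘
      ; ▽-incr   = λ x → cong lift (▽-incr (lower x))
      ; ▽-⊓      = λ x y → cong lift (▽-⊓ (lower x) (lower y))
      ; ▽-compl  = λ x → cong lift (▽-compl (lower x))
      }
    }
    where open ISA A; open IsISA isISA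

  eval-lift : ∀ (A : RawISA a) φ v → eval (liftRaw A) φ (lift ∘ v) ≡ lift (eval A φ v)
  eval-lift A (var x)  v = refl
  eval-lift A (φ ∧ᶠ ψ) v = cong₂ (RawISA._⊓_ (liftRaw A)) (eval-lift A φ v) (eval-lift A ψ v)
  eval-lift A (φ ∨ᶠ ψ) v = cong₂ (RawISA._⊔'_ (liftRaw A)) (eval-lift A φ v) (eval-lift A ψ v)
  eval-lift A (¬ᶠ φ)   v = cong (RawISA.∼_ (liftRaw A)) (eval-lift A φ v)
  eval-lift A (∇ᶠ φ)   v = cong (RawISA.▽_ (liftRaw A)) (eval-lift A φ v)
  eval-lift A ⊥ᶠ       v = refl
  eval-lift A ⊤ᶠ       v = refl

-- Negation normal form and clauses

data Kind : Set where
  `x `¬x `∇x `¬∇x `∇¬x `¬∇¬x : Kind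

negate : Kind → Kind
negate `x    = `¬x
negate `¬x   = `x
negate `∇x   = `¬∇x
negate `¬∇x  = `∇x
negate `∇¬x  = `¬∇¬x
negate `¬∇¬x = `∇¬x

data NNF : Set where
  atom : Kind → ℕ → NNF
  _∧ⁿ_ _∨ⁿ_ : NNF → NNF → NNF
  ⊥ⁿ ⊤ⁿ : NNF

∼ⁿ : NNF → NNF
∼ⁿ (atom k x) = atom (negate k) x
∼ⁿ (φ ∧ⁿ ψ)   = ∼ⁿ φ ∨ⁿ ∼ⁿ ψ
∼ⁿ (φ ∨ⁿ ψ)   = ∼ⁿ φ ∧ⁿ ∼ⁿ ψ
∼ⁿ ⊥ⁿ         = ⊤ⁿ
∼ⁿ ⊤ⁿ         = ⊥ⁿ

-- nnf∇ φ and nnf∇¬ φ are normal forms of ∇φ and ∇¬φ.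
nnf nnf∇ nnf∇¬ : Fm → NNF
nnf (var x)  = atom `x x
nnf (φ ∧ᶠ ψ) = nnf φ ∧ⁿ nnf ψ
nnf (φ ∨ᶠ ψ) = nnf φ ∨ⁿ nnf ψ
nnf (¬ᶠ φ)   = ∼ⁿ (nnf φ)
nnf (∇ᶠ φ)   = nnf∇ φ
nnf ⊥ᶠ       = ⊥ⁿ
nnf ⊤ᶠ       = ⊤ⁿ
nnf∇ (var x)  = atom `∇x x
nnf∇ (φ ∧ᶠ ψ) = nnf∇ φ ∧ⁿ nnf∇ ψ
nnf∇ (φ ∨ᶠ ψ) = nnf∇ φ ∨ⁿ nnf∇ ψ
nnf∇ (¬ᶠ φ)   = nnf∇¬ φ
nnf∇ (∇ᶠ φ)   = nnf∇ φ
nnf∇ ⊥ᶠ       = ⊥ⁿ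
nnf∇ ⊤ᶠ       = ⊤ⁿ
nnf∇¬ (var x)  = atom `∇¬x x
nnf∇¬ (φ ∧ᶠ ψ) = nnf∇¬ φ ∨ⁿ nnf∇¬ ψ
nnf∇¬ (φ ∨ᶠ ψ) = nnf∇¬ φ ∧ⁿ nnf∇¬ ψ
nnf∇¬ (¬ᶠ φ)   = nnf∇ φ
nnf∇¬ (∇ᶠ φ)   = ∼ⁿ (nnf∇ φ)
nnf∇¬ ⊥ᶠ       = ⊤ⁿ
nnf∇¬ ⊤ᶠ       = ⊥ⁿ

Literal : Set
Literal = Kind × ℕ

Clause : Set
Clause = List Literal

negateClause : Clause → Clause
negateClause = map (map₁ negate)

dnf : NNF → List Clause
dnf (atom k x) = [ [ k , x ] ]
dnf (φ ∧ⁿ ψ)   = cartesianProductWith _++_ (dnf φ) (dnf ψ)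
dnf (φ ∨ⁿ ψ)   = dnf φ ++ dnf ψ
dnf ⊥ⁿ         = []
dnf ⊤ⁿ         = [ [] ]

cnf : NNF → List Clause
cnf φ = map negateClause (dnf (∼ⁿ φ))

kindsOn : ℕ → Clause → List Kind
kindsOn x C = map proj₁ (filter (λ l → proj₂ l ≟ x) C)

∈-kindsOn⁺ : ∀ {k x C} → (k , x) ∈ C → k ∈ kindsOn x C
∈-kindsOn⁺ k,x∈C = ∈-map⁺ proj₁ (∈-filter⁺ (λ l → proj₂ l ≟ _) k,x∈C refl)

∈-kindsOn⁻ : ∀ {k x C} → k ∈ kindsOn x C → (k , x) ∈ C
∈-kindsOn⁻ {x = x} k∈ with ∈-map⁻ proj₁ k∈
... | _ , l∈ , refl with ∈-filter⁻ (λ l → proj₂ l ≟ x) l∈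
...   | k,x∈C , refl = k,x∈C

module Properties {ℓ} (A : ISA ℓ) where
  open ISA A public using (Carrier; raw; ∼_; ▽_; 𝟘; 𝟙)
  open IsISA (ISA.isISA A)

  -- Its order is x ≡ x ∧ y, the symmetric form of the order a ⊓ b ≡ a of Defs.
  lattice : Lattice ℓ ℓ ℓ
  lattice = AlgLatticeProperties.∨-∧-orderTheoreticLattice (record { isLattice = isLattice })
    where
    isLattice : IsAlgLattice _≡_ (ISA._⊔'_ A) (ISA._⊓_ A)
    isLattice = record
      { isEquivalence = isEquivalence
      ; ∨-comm = ⊔-comm ; ∨-assoc = ⊔-assoc ; ∨-cong = cong₂ _
      ; ∧-comm = ⊓-comm ; ∧-assoc = ⊓-assoc ; ∧-cong = cong₂ _
      ; absorptive = ⊔-absorb , ⊓-absorb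
      }

  open Lattice lattice public
    using (_≤_; _∧_; _∨_; poset; x∧y≤x; x∧y≤y; ∧-greatest; x≤x∨y; y≤x∨y; ∨-least)
    renaming (refl to ≤-refl; trans to ≤-trans; antisym to ≤-antisym; reflexive to ≤-reflexive)
  open MeetSemilatticeProperties (Lattice.meetSemilattice lattice) public using (∧-monotonic)
  open JoinSemilatticeProperties (Lattice.joinSemilattice lattice) public using (∨-monotonic)
  module ≤-Reasoning = PartialOrderReasoning poset
  open ≤-Reasoning

  𝟘≤ : ∀ {a} → 𝟘 ≤ a
  𝟘≤ {a} = sym (𝟘-bot a)

  ≤𝟙 : ∀ {a} → a ≤ 𝟙
  ≤𝟙 {a} = sym (𝟙-top a)

  ∧-zeroʳ : ∀ a → a ∧ 𝟘 ≡ 𝟘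
  ∧-zeroʳ a = trans (⊓-comm a 𝟘) (𝟘-bot a)

  ∨-identityˡ : ∀ a → 𝟘 ∨ a ≡ a
  ∨-identityˡ a = ≤-antisym (∨-least 𝟘≤ ≤-refl) (y≤x∨y 𝟘 a)

  ∨-identityʳ : ∀ a → a ∨ 𝟘 ≡ a
  ∨-identityʳ a = trans (⊔-comm a 𝟘) (∨-identityˡ a)

  ∧-identityˡ : ∀ a → 𝟙 ∧ a ≡ a
  ∧-identityˡ a = trans (⊓-comm 𝟙 a) (𝟙-top a)

  ∧-distribʳ-∨ : ∀ a b c → (b ∨ c) ∧ a ≡ b ∧ a ∨ c ∧ a
  ∧-distribʳ-∨ a b c = begin-equality
    (b ∨ c) ∧ a      ≡⟨ ⊓-comm (b ∨ c) a ⟩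
    a ∧ (b ∨ c)      ≡⟨ distrib a b c ⟩
    a ∧ b ∨ a ∧ c    ≡⟨ cong₂ _∨_ (⊓-comm a b) (⊓-comm a c) ⟩
    b ∧ a ∨ c ∧ a    ∎

  ∼-antitone : ∀ {a b} → a ≤ b → ∼ b ≤ ∼ a
  ∼-antitone {a} {b} a≤b = begin
    ∼ b           ≤⟨ y≤x∨y (∼ a) (∼ b) ⟩
    ∼ a ∨ ∼ b     ≡⟨ deMorgan a b ⟨
    ∼ (a ∧ b)     ≡⟨ cong ∼_ a≤b ⟨
    ∼ a           ∎

  ∼-∨ : ∀ a b → ∼ (a ∨ b) ≡ ∼ a ∧ ∼ b
  ∼-∨ a b = begin-equality
    ∼ (a ∨ b)             ≡⟨ cong ∼_ (cong₂ _∨_ (∼∼ a) (∼∼ b)) ⟨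
    ∼ (∼ ∼ a ∨ ∼ ∼ b)     ≡⟨ cong ∼_ (deMorgan (∼ a) (∼ b)) ⟨
    ∼ ∼ (∼ a ∧ ∼ b)       ≡⟨ ∼∼ (∼ a ∧ ∼ b) ⟩
    ∼ a ∧ ∼ b             ∎

  ∼𝟘 : ∼ 𝟘 ≡ 𝟙
  ∼𝟘 = ≤-antisym ≤𝟙 (subst (_≤ ∼ 𝟘) (∼∼ 𝟙) (∼-antitone 𝟘≤))

  ∼𝟙 : ∼ 𝟙 ≡ 𝟘
  ∼𝟙 = ≤-antisym (subst (∼ 𝟙 ≤_) (∼∼ 𝟘) (∼-antitone ≤𝟙)) 𝟘≤

  split : ∀ {e f t s} → 𝟙 ≤ e ∨ f → t ∧ e ≤ s → t ∧ f ≤ s → t ≤ s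
  split {e} {f} {t} {s} e∨f t∧e≤s t∧f≤s = begin
    t                ≤⟨ ∧-greatest ≤-refl (≤-trans ≤𝟙 e∨f) ⟩
    t ∧ (e ∨ f)      ≡⟨ distrib t e f ⟩
    t ∧ e ∨ t ∧ f    ≤⟨ ∨-least t∧e≤s t∧f≤s ⟩
    s                ∎

  ≤-complement : ∀ {e f t} → 𝟙 ≤ e ∨ f → t ∧ f ≤ 𝟘 → t ≤ e
  ≤-complement e∨f t∧f≤𝟘 = split e∨f (x∧y≤y _ _) (≤-trans t∧f≤𝟘 𝟘≤)

  ▽-inflationary : ∀ {a} → a ≤ ▽ a
  ▽-inflationary {a} = sym (▽-incr a)

  ▽-monotone : ∀ {a b} → a ≤ b → ▽ a ≤ ▽ b
  ▽-monotone {a} {b} a≤b = trans (cong ▽_ a≤b) (▽-⊓ a b)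

  ▽-disjoint : ∀ a → ▽ a ∧ ∼ ▽ a ≤ 𝟘
  ▽-disjoint a = ≤-reflexive (trans (⊓-comm (▽ a) (∼ ▽ a)) (▽-compl a))

  ∼▽-disjoint : ∀ a → ∼ ▽ a ∧ ▽ a ≤ 𝟘
  ∼▽-disjoint a = ≤-reflexive (▽-compl a)

  ▽-complemented : ∀ a → 𝟙 ≤ ▽ a ∨ ∼ ▽ a
  ▽-complemented a = ≤-reflexive (begin-equality
    𝟙                   ≡⟨ ∼𝟘 ⟨
    ∼ 𝟘                 ≡⟨ cong ∼_ (▽-compl a) ⟨
    ∼ (∼ ▽ a ∧ ▽ a)     ≡⟨ deMorgan (∼ ▽ a) (▽ a) ⟩
    ∼ ∼ ▽ a ∨ ∼ ▽ a     ≡⟨ cong (_∨ ∼ ▽ a) (∼∼ (▽ a)) ⟩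
    ▽ a ∨ ∼ ▽ a         ∎)

  ▽-preserves-disjoint : ∀ {b c} → b ∧ c ≤ 𝟘 → ▽ b ∧ ▽ c ≤ 𝟘
  ▽-preserves-disjoint {b} {c} b∧c≤𝟘 = begin
    ▽ b ∧ ▽ c      ≡⟨ ▽-⊓ b c ⟨
    ▽ (b ∧ c)      ≤⟨ ▽-monotone b∧c≤𝟘 ⟩
    ▽ 𝟘            ≡⟨ ▽𝟘 ⟩
    𝟘              ∎

  ▽-kills : ∀ {b c} → b ∧ c ≤ 𝟘 → ▽ b ∧ c ≤ 𝟘
  ▽-kills b∧c≤𝟘 = ≤-trans (∧-monotonic ≤-refl ▽-inflationary) (▽-preserves-disjoint b∧c≤𝟘)

  ▽▽ : ∀ a → ▽ ▽ a ≡ ▽ a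
  ▽▽ a = ≤-antisym (≤-complement (▽-complemented a) (▽-kills (▽-disjoint a))) ▽-inflationary

  ▽∼▽ : ∀ a → ▽ ∼ ▽ a ≡ ∼ ▽ a
  ▽∼▽ a = ≤-antisym
    (≤-complement (subst (𝟙 ≤_) (⊔-comm (▽ a) (∼ ▽ a)) (▽-complemented a))
                  (▽-kills (∼▽-disjoint a)))
    ▽-inflationary

  ▽-∨ : ∀ a b → ▽ (a ∨ b) ≡ ▽ a ∨ ▽ b
  ▽-∨ a b = ≤-antisym
    (split (▽-complemented a) (≤-trans (x∧y≤y _ _) (x≤x∨y _ _))
      (split (▽-complemented b) (≤-trans (x∧y≤y _ _) (y≤x∨y _ _))
        (≤-trans killed 𝟘≤)))
    (∨-least (▽-monotone (x≤x∨y a b)) (▽-monotone (y≤x∨y a b)))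
    where
    outside : (a ∨ b) ∧ (∼ ▽ a ∧ ∼ ▽ b) ≤ 𝟘
    outside = begin
      (a ∨ b) ∧ (∼ ▽ a ∧ ∼ ▽ b)                          ≡⟨ ∧-distribʳ-∨ _ a b ⟩
      a ∧ (∼ ▽ a ∧ ∼ ▽ b) ∨ b ∧ (∼ ▽ a ∧ ∼ ▽ b)
        ≤⟨ ∨-monotonic (∧-monotonic ▽-inflationary (x∧y≤x _ _))
                       (∧-monotonic ▽-inflationary (x∧y≤y _ _)) ⟩
      ▽ a ∧ ∼ ▽ a ∨ ▽ b ∧ ∼ ▽ b                          ≤⟨ ∨-least (▽-disjoint a) (▽-disjoint b) ⟩
      𝟘                                                  ∎
    killed : (▽ (a ∨ b) ∧ ∼ ▽ a) ∧ ∼ ▽ b ≤ 𝟘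
    killed = begin
      (▽ (a ∨ b) ∧ ∼ ▽ a) ∧ ∼ ▽ b      ≡⟨ ⊓-assoc (▽ (a ∨ b)) (∼ ▽ a) (∼ ▽ b) ⟩
      ▽ (a ∨ b) ∧ (∼ ▽ a ∧ ∼ ▽ b)      ≤⟨ ▽-kills outside ⟩
      𝟘                                ∎

  ▽𝟙 : ▽ 𝟙 ≡ 𝟙
  ▽𝟙 = ≤-antisym ≤𝟙 ▽-inflationary

  ∼▽≤∼ : ∀ {a} → ∼ ▽ a ≤ ∼ a
  ∼▽≤∼ = ∼-antitone ▽-inflationary

  ∼▽∼≤ : ∀ {a} → ∼ ▽ ∼ a ≤ a
  ∼▽∼≤ {a} = subst (∼ ▽ ∼ a ≤_) (∼∼ a) ∼▽≤∼

  regions : ∀ a {t s} → t ∧ ∼ ▽ a ≤ s → t ∧ ∼ ▽ ∼ a ≤ s → t ∧ (▽ a ∧ ▽ ∼ a) ≤ s → t ≤ s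
  regions a {t} bottom top middle = split (▽-complemented a)
    (split (▽-complemented (∼ a)) (≤-trans (≤-reflexive (⊓-assoc t (▽ a) (▽ ∼ a))) middle)
                                  (≤-trans (∧-monotonic (x∧y≤x _ _) ≤-refl) top))
    bottom

  ⨆ ⨅ : List Carrier → Carrier
  ⨆ []       = 𝟘
  ⨆ (x ∷ xs) = x ∨ ⨆ xs
  ⨅ []       = 𝟙
  ⨅ (x ∷ xs) = x ∧ ⨅ xs

  module _ {b} {B : Set b} (f : B → Carrier) where

    ≤⨆ : ∀ {x xs} → x ∈ xs → f x ≤ ⨆ (map f xs)
    ≤⨆ (here refl)  = x≤x∨y _ _
    ≤⨆ (there x∈xs) = ≤-trans (≤⨆ x∈xs) (y≤x∨y _ _)

    ⨅≤ : ∀ {x xs} → x ∈ xs → ⨅ (map f xs) ≤ f x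
    ⨅≤ (here refl)  = x∧y≤x _ _
    ⨅≤ (there x∈xs) = ≤-trans (x∧y≤y _ _) (⨅≤ x∈xs)

    ⨆-least : ∀ {xs t} → (∀ {x} → x ∈ xs → f x ≤ t) → ⨆ (map f xs) ≤ t
    ⨆-least {[]}     bounded = 𝟘≤
    ⨆-least {x ∷ xs} bounded = ∨-least (bounded (here refl)) (⨆-least (bounded ∘ there))

    ⨅-greatest : ∀ {xs t} → (∀ {x} → x ∈ xs → t ≤ f x) → t ≤ ⨅ (map f xs)
    ⨅-greatest {[]}     bounded = ≤𝟙
    ⨅-greatest {x ∷ xs} bounded = ∧-greatest (bounded (here refl)) (⨅-greatest (bounded ∘ there))

  ⨆-++ : ∀ xs ys → ⨆ (xs ++ ys) ≡ ⨆ xs ∨ ⨆ ys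
  ⨆-++ []       ys = sym (∨-identityˡ (⨆ ys))
  ⨆-++ (x ∷ xs) ys = trans (cong (x ∨_) (⨆-++ xs ys)) (sym (⊔-assoc x (⨆ xs) (⨆ ys)))

  ⨅-++ : ∀ xs ys → ⨅ (xs ++ ys) ≡ ⨅ xs ∧ ⨅ ys
  ⨅-++ []       ys = sym (∧-identityˡ (⨅ ys))
  ⨅-++ (x ∷ xs) ys = trans (cong (x ∧_) (⨅-++ xs ys)) (sym (⊓-assoc x (⨅ xs) (⨅ ys)))

  module _ {b} {B : Set b} {_·_ : B → B → B} (g : B → Carrier)
           (g-· : ∀ x y → g (x · y) ≡ g x ∧ g y) where

    ⨆-map-row : ∀ x ys → ⨆ (map g (map (x ·_) ys)) ≡ g x ∧ ⨆ (map g ys)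
    ⨆-map-row x []       = sym (∧-zeroʳ (g x))
    ⨆-map-row x (y ∷ ys) = begin-equality
      g (x · y) ∨ ⨆ (map g (map (x ·_) ys))   ≡⟨ cong₂ _∨_ (g-· x y) (⨆-map-row x ys) ⟩
      g x ∧ g y ∨ g x ∧ ⨆ (map g ys)          ≡⟨ distrib (g x) (g y) _ ⟨
      g x ∧ (g y ∨ ⨆ (map g ys))              ∎

    ⨆-map-cartesianProduct : ∀ xs ys →
      ⨆ (map g (cartesianProductWith _·_ xs ys)) ≡ ⨆ (map g xs) ∧ ⨆ (map g ys)
    ⨆-map-cartesianProduct []       ys = sym (𝟘-bot _)
    ⨆-map-cartesianProduct (x ∷ xs) ys = begin-equality
      ⨆ (map g (map (x ·_) ys ++ cartesianProductWith _·_ xs ys))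
        ≡⟨ cong ⨆ (map-++ g (map (x ·_) ys) _) ⟩
      ⨆ (map g (map (x ·_) ys) ++ map g (cartesianProductWith _·_ xs ys))
        ≡⟨ ⨆-++ (map g (map (x ·_) ys)) _ ⟩
      ⨆ (map g (map (x ·_) ys)) ∨ ⨆ (map g (cartesianProductWith _·_ xs ys))
        ≡⟨ cong₂ _∨_ (⨆-map-row x ys) (⨆-map-cartesianProduct xs ys) ⟩
      g x ∧ ⨆ (map g ys) ∨ ⨆ (map g xs) ∧ ⨆ (map g ys)
        ≡⟨ ∧-distribʳ-∨ _ (g x) _ ⟨
      (g x ∨ ⨆ (map g xs)) ∧ ⨆ (map g ys)
        ∎

  lit : Kind → Carrier → Carrier
  lit `x    a = a
  lit `¬x   a = ∼ a
  lit `∇x   a = ▽ a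
  lit `¬∇x  a = ∼ ▽ a
  lit `∇¬x  a = ▽ ∼ a
  lit `¬∇¬x a = ∼ ▽ ∼ a

  lit-negate : ∀ k a → lit (negate k) a ≡ ∼ lit k a
  lit-negate `x    a = refl
  lit-negate `¬x   a = sym (∼∼ a)
  lit-negate `∇x   a = refl
  lit-negate `¬∇x  a = sym (∼∼ (▽ a))
  lit-negate `∇¬x  a = refl
  lit-negate `¬∇¬x a = sym (∼∼ (▽ ∼ a))

  lits : List Kind → Carrier → List Carrier
  lits P a = map (λ k → lit k a) P

  Valuation : Set ℓ
  Valuation = ℕ → Carrier

  ⟦_⟧ⁿ : NNF → Valuation → Carrier
  ⟦ atom k x ⟧ⁿ v = lit k (v x)
  ⟦ φ ∧ⁿ ψ ⟧ⁿ   v = ⟦ φ ⟧ⁿ v ∧ ⟦ ψ ⟧ⁿ v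
  ⟦ φ ∨ⁿ ψ ⟧ⁿ   v = ⟦ φ ⟧ⁿ v ∨ ⟦ ψ ⟧ⁿ v
  ⟦ ⊥ⁿ ⟧ⁿ       v = 𝟘
  ⟦ ⊤ⁿ ⟧ⁿ       v = 𝟙

  ⟦∼ⁿ⟧ : ∀ φ v → ⟦ ∼ⁿ φ ⟧ⁿ v ≡ ∼ ⟦ φ ⟧ⁿ v
  ⟦∼ⁿ⟧ (atom k x) v = lit-negate k (v x)
  ⟦∼ⁿ⟧ (φ ∧ⁿ ψ)   v = trans (cong₂ _∨_ (⟦∼ⁿ⟧ φ v) (⟦∼ⁿ⟧ ψ v)) (sym (deMorgan _ _))
  ⟦∼ⁿ⟧ (φ ∨ⁿ ψ)   v = trans (cong₂ _∧_ (⟦∼ⁿ⟧ φ v) (⟦∼ⁿ⟧ ψ v)) (sym (∼-∨ _ _))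
  ⟦∼ⁿ⟧ ⊥ⁿ         v = sym ∼𝟘
  ⟦∼ⁿ⟧ ⊤ⁿ         v = sym ∼𝟙

  nnf-sound   : ∀ φ v → ⟦ nnf φ ⟧ⁿ v ≡ eval raw φ v
  nnf∇-sound  : ∀ φ v → ⟦ nnf∇ φ ⟧ⁿ v ≡ ▽ eval raw φ v
  nnf∇¬-sound : ∀ φ v → ⟦ nnf∇¬ φ ⟧ⁿ v ≡ ▽ ∼ eval raw φ v
  nnf-sound (var x)  v = refl
  nnf-sound (φ ∧ᶠ ψ) v = cong₂ _∧_ (nnf-sound φ v) (nnf-sound ψ v)
  nnf-sound (φ ∨ᶠ ψ) v = cong₂ _∨_ (nnf-sound φ v) (nnf-sound ψ v)
  nnf-sound (¬ᶠ φ)   v = trans (⟦∼ⁿ⟧ (nnf φ) v) (cong ∼_ (nnf-sound φ v))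
  nnf-sound (∇ᶠ φ)   v = nnf∇-sound φ v
  nnf-sound ⊥ᶠ       v = refl
  nnf-sound ⊤ᶠ       v = refl
  nnf∇-sound (var x)  v = refl
  nnf∇-sound (φ ∧ᶠ ψ) v = trans (cong₂ _∧_ (nnf∇-sound φ v) (nnf∇-sound ψ v)) (sym (▽-⊓ _ _))
  nnf∇-sound (φ ∨ᶠ ψ) v = trans (cong₂ _∨_ (nnf∇-sound φ v) (nnf∇-sound ψ v)) (sym (▽-∨ _ _))
  nnf∇-sound (¬ᶠ φ)   v = nnf∇¬-sound φ v
  nnf∇-sound (∇ᶠ φ)   v = trans (nnf∇-sound φ v) (sym (▽▽ _))
  nnf∇-sound ⊥ᶠ       v = sym ▽𝟘
  nnf∇-sound ⊤ᶠ       v = sym ▽𝟙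
  nnf∇¬-sound (var x)  v = refl
  nnf∇¬-sound (φ ∧ᶠ ψ) v = trans (cong₂ _∨_ (nnf∇¬-sound φ v) (nnf∇¬-sound ψ v))
    (sym (trans (cong ▽_ (deMorgan _ _)) (▽-∨ _ _)))
  nnf∇¬-sound (φ ∨ᶠ ψ) v = trans (cong₂ _∧_ (nnf∇¬-sound φ v) (nnf∇¬-sound ψ v))
    (sym (trans (cong ▽_ (∼-∨ _ _)) (▽-⊓ _ _)))
  nnf∇¬-sound (¬ᶠ φ)   v = trans (nnf∇-sound φ v) (cong ▽_ (sym (∼∼ _)))
  nnf∇¬-sound (∇ᶠ φ)   v = trans (⟦∼ⁿ⟧ (nnf∇ φ) v)
    (trans (cong ∼_ (nnf∇-sound φ v)) (sym (▽∼▽ _)))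
  nnf∇¬-sound ⊥ᶠ       v = trans (sym ▽𝟙) (cong ▽_ (sym ∼𝟘))
  nnf∇¬-sound ⊤ᶠ       v = trans (sym ▽𝟘) (cong ▽_ (sym ∼𝟙))

  ⟦_⟧ˡ : Literal → Valuation → Carrier
  ⟦ k , x ⟧ˡ v = lit k (v x)

  conj disj : Clause → Valuation → Carrier
  conj C v = ⨅ (map (λ l → ⟦ l ⟧ˡ v) C)
  disj D v = ⨆ (map (λ l → ⟦ l ⟧ˡ v) D)

  ⟦_⟧ᵈ ⟦_⟧ᶜ : List Clause → Valuation → Carrier
  ⟦ Cs ⟧ᵈ v = ⨆ (map (λ C → conj C v) Cs)
  ⟦ Ds ⟧ᶜ v = ⨅ (map (λ D → disj D v) Ds)

  conj-++ : ∀ C D v → conj (C ++ D) v ≡ conj C v ∧ conj D v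
  conj-++ C D v = trans (cong ⨅ (map-++ (λ l → ⟦ l ⟧ˡ v) C D))
    (⨅-++ (map (λ l → ⟦ l ⟧ˡ v) C) (map (λ l → ⟦ l ⟧ˡ v) D))

  dnf-sound : ∀ φ v → ⟦ dnf φ ⟧ᵈ v ≡ ⟦ φ ⟧ⁿ v
  dnf-sound (atom k x) v = trans (∨-identityʳ _) (𝟙-top _)
  dnf-sound (φ ∧ⁿ ψ)   v = trans (⨆-map-cartesianProduct (λ C → conj C v) (λ C D → conj-++ C D v) (dnf φ) (dnf ψ))
    (cong₂ _∧_ (dnf-sound φ v) (dnf-sound ψ v))
  dnf-sound (φ ∨ⁿ ψ)   v = trans (cong ⨆ (map-++ (λ C → conj C v) (dnf φ) (dnf ψ)))
    (trans (⨆-++ (map (λ C → conj C v) (dnf φ)) _) (cong₂ _∨_ (dnf-sound φ v) (dnf-sound ψ v)))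
  dnf-sound ⊥ⁿ         v = refl
  dnf-sound ⊤ⁿ         v = ∨-identityʳ 𝟙

  disj-negateClause : ∀ C v → disj (negateClause C) v ≡ ∼ conj C v
  disj-negateClause []            v = sym ∼𝟙
  disj-negateClause ((k , x) ∷ C) v =
    trans (cong₂ _∨_ (lit-negate k (v x)) (disj-negateClause C v)) (sym (deMorgan _ _))

  cnf-negate : ∀ Cs v → ⟦ map negateClause Cs ⟧ᶜ v ≡ ∼ ⟦ Cs ⟧ᵈ v
  cnf-negate []       v = sym ∼𝟘
  cnf-negate (C ∷ Cs) v =
    trans (cong₂ _∧_ (disj-negateClause C v) (cnf-negate Cs v)) (sym (∼-∨ _ _))

  cnf-sound : ∀ φ v → ⟦ cnf φ ⟧ᶜ v ≡ ⟦ φ ⟧ⁿ v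
  cnf-sound φ v = begin-equality
    ⟦ cnf φ ⟧ᶜ v          ≡⟨ cnf-negate (dnf (∼ⁿ φ)) v ⟩
    ∼ ⟦ dnf (∼ⁿ φ) ⟧ᵈ v   ≡⟨ cong ∼_ (dnf-sound (∼ⁿ φ) v) ⟩
    ∼ ⟦ ∼ⁿ φ ⟧ⁿ v         ≡⟨ cong ∼_ (⟦∼ⁿ⟧ φ v) ⟩
    ∼ ∼ ⟦ φ ⟧ⁿ v          ≡⟨ ∼∼ _ ⟩
    ⟦ φ ⟧ⁿ v              ∎

  dnf-form : ∀ φ v → eval raw φ v ≡ ⟦ dnf (nnf φ) ⟧ᵈ v
  dnf-form φ v = sym (trans (dnf-sound (nnf φ) v) (nnf-sound φ v))

  cnf-form : ∀ φ v → eval raw φ v ≡ ⟦ cnf (nnf φ) ⟧ᶜ v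
  cnf-form φ v = sym (trans (cnf-sound (nnf φ) v) (nnf-sound φ v))

  conj≤dnf : ∀ {C Cs} v → C ∈ Cs → conj C v ≤ ⟦ Cs ⟧ᵈ v
  conj≤dnf v = ≤⨆ (λ C → conj C v)

  cnf≤disj : ∀ {D Ds} v → D ∈ Ds → ⟦ Ds ⟧ᶜ v ≤ disj D v
  cnf≤disj v = ⨅≤ (λ D → disj D v)

  dnf≤cnf : ∀ {Cs Ds} v → (∀ {C D} → C ∈ Cs → D ∈ Ds → conj C v ≤ disj D v) → ⟦ Cs ⟧ᵈ v ≤ ⟦ Ds ⟧ᶜ v
  dnf≤cnf v pairwise = ⨆-least (λ C → conj C v) λ C∈Cs →
    ⨅-greatest (λ D → disj D v) λ D∈Ds → pairwise C∈Cs D∈Ds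

  conj≤kindsOn : ∀ C x v → conj C v ≤ ⨅ (lits (kindsOn x C) (v x))
  conj≤kindsOn C x v = ⨅-greatest (λ k → lit k (v x)) λ k∈ →
    ⨅≤ (λ l → ⟦ l ⟧ˡ v) (∈-kindsOn⁻ {C = C} k∈)

  kindsOn≤disj : ∀ D x v → ⨆ (lits (kindsOn x D) (v x)) ≤ disj D v
  kindsOn≤disj D x v = ⨆-least (λ k → lit k (v x)) λ k∈ →
    ≤⨆ (λ l → ⟦ l ⟧ˡ v) (∈-kindsOn⁻ {C = D} k∈)

module Six = Properties 𝕊₆-ISA
open Six using () renaming (_≤_ to _≤₆_; lit to lit₆)

infix 4 _≤₆?_
_≤₆?_ : ∀ x y → Dec (x ≤₆ y)
x ≤₆? y = x ≟₆ x ⊓₆ y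

N≰B : ¬ sN ≤₆ sB
N≰B ()

N≰0 : ¬ sN ≤₆ s0
N≰0 ()

1≰B : ¬ s1 ≤₆ sB
1≰B ()

-- ↑N = {N, ⅔, 1} is a prime filter of 𝕊₆ whose complement is ↓B = {0, ⅓, B}.
≰N⇒≤B : ∀ w → ¬ sN ≤₆ w → w ≤₆ sB
≰N⇒≤B = from-yes (all₆? λ w → ¬? (sN ≤₆? w) →-dec w ≤₆? sB)

≰B⇒≥N : ∀ w → ¬ w ≤₆ sB → sN ≤₆ w
≰B⇒≥N = from-yes (all₆? λ w → ¬? (w ≤₆? sB) →-dec sN ≤₆? w)

Separates : List Kind → List Kind → S6 → Set
Separates P Q u = All (λ k → sN ≤₆ lit₆ k u) P × All (λ k → lit₆ k u ≤₆ sB) Q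

separates? : ∀ P Q → Decidable (Separates P Q)
separates? P Q u = all? (λ k → sN ≤₆? lit₆ k u) P ×-dec all? (λ k → lit₆ k u ≤₆? sB) Q

Obstruction : List Kind → List Kind → S6 → Set
Obstruction P Q u = (∃ λ k → k ∈ P × lit₆ k u ≤₆ sB) ⊎ (∃ λ k → k ∈ Q × sN ≤₆ lit₆ k u)

obstruction : ∀ {P Q u} → ¬ Separates P Q u → Obstruction P Q u
obstruction {P} {Q} {u} ¬separates with all? (λ k → sN ≤₆? lit₆ k u) P
... | no ¬allP = inj₁ (let k , k∈P , h = find (¬All⇒Any¬ (λ k → sN ≤₆? lit₆ k u) P ¬allP)
                       in k , k∈P , ≰N⇒≤B _ h)
... | yes allP = inj₂ (let k , k∈Q , h = find (¬All⇒Any¬ (λ k → lit₆ k u ≤₆? sB) Q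
                                                 (λ allQ → ¬separates (allP , allQ)))
                       in k , k∈Q , ≰B⇒≥N _ h)

data PlainObstruction (P Q : List Kind) (u : S6) : Set where
  P∋x  : `x ∈ P  → u ≤₆ sB → PlainObstruction P Q u
  P∋¬x : `¬x ∈ P → ¬₆ u ≤₆ sB → PlainObstruction P Q u
  Q∋x  : `x ∈ Q  → sN ≤₆ u → PlainObstruction P Q u
  Q∋¬x : `¬x ∈ Q → sN ≤₆ ¬₆ u → PlainObstruction P Q u

-- N and B each force a membership; if these are x and ¬x on opposite sides,
-- ⅓ or ⅔ forces a shared one.
plain-shared : ∀ {P Q} → PlainObstruction P Q sN → PlainObstruction P Q sB →
               PlainObstruction P Q s⅔ → PlainObstruction P Q s⅓ → ∃ λ k → k ∈ P × k ∈ Q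
plain-shared (Q∋x q _)  (P∋x p _)  _ _ = `x , p , q
plain-shared (Q∋¬x q _) (P∋¬x p _) _ _ = `¬x , p , q
plain-shared (Q∋x q _)  (P∋¬x _ _) _ (P∋x p _)  = `x , p , q
plain-shared (Q∋x _ _)  (P∋¬x p _) _ (Q∋¬x q _) = `¬x , p , q
plain-shared (Q∋¬x q _) (P∋x _ _)  (P∋¬x p _) _ = `¬x , p , q
plain-shared (Q∋¬x _ _) (P∋x p _)  (Q∋x q _)  _ = `x , p , q
plain-shared (P∋x _ ())  _ _ _
plain-shared (P∋¬x _ ()) _ _ _
plain-shared _ (Q∋x _ ())  _ _
plain-shared _ (Q∋¬x _ ()) _ _
plain-shared (Q∋x _ _)  (P∋¬x _ _) _ (P∋¬x _ ())
plain-shared (Q∋x _ _)  (P∋¬x _ _) _ (Q∋x _ ())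
plain-shared (Q∋¬x _ _) (P∋x _ _)  (P∋x _ ())  _
plain-shared (Q∋¬x _ _) (P∋x _ _)  (Q∋¬x _ ()) _

-- Completeness for a single variable

module OneVariable {ℓ} (A : ISA ℓ) (P Q : List Kind) (a : ISA.Carrier A) where
  open Properties A
  open ≤-Reasoning

  HoldsOn : Carrier → Set ℓ
  HoldsOn r = ⨅ (lits P a) ∧ r ≤ ⨆ (lits Q a)

  killed : ∀ {k e r} → k ∈ P → lit k a ≤ e → e ∧ r ≤ 𝟘 → HoldsOn r
  killed {k} {e} {r} k∈P k≤e e∧r≤𝟘 = begin
    ⨅ (lits P a) ∧ r    ≤⟨ ∧-monotonic (≤-trans (⨅≤ (λ k → lit k a) k∈P) k≤e) ≤-refl ⟩
    e ∧ r               ≤⟨ e∧r≤𝟘 ⟩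
    𝟘                   ≤⟨ 𝟘≤ ⟩
    ⨆ (lits Q a)        ∎

  covered : ∀ {k r} → k ∈ Q → r ≤ lit k a → HoldsOn r
  covered {k} {r} k∈Q r≤k = begin
    ⨅ (lits P a) ∧ r    ≤⟨ x∧y≤y _ r ⟩
    r                   ≤⟨ r≤k ⟩
    lit k a             ≤⟨ ≤⨆ (λ k → lit k a) k∈Q ⟩
    ⨆ (lits Q a)        ∎

  shared : ∀ {k} → k ∈ P → k ∈ Q → ⨅ (lits P a) ≤ ⨆ (lits Q a)
  shared k∈P k∈Q = ≤-trans (⨅≤ (λ k → lit k a) k∈P) (≤⨆ (λ k → lit k a) k∈Q)

  bottom-kill : ∀ k → lit₆ k s0 ≤₆ sB → lit k a ≤ ▽ a
  bottom-kill `x    _ = ▽-inflationary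
  bottom-kill `∇x   _ = ≤-refl
  bottom-kill `¬∇¬x _ = ≤-trans ∼▽∼≤ ▽-inflationary
  bottom-kill `¬x   ()
  bottom-kill `¬∇x  ()
  bottom-kill `∇¬x  ()

  bottom-cover : ∀ k → sN ≤₆ lit₆ k s0 → ∼ ▽ a ≤ lit k a
  bottom-cover `¬x   _ = ∼▽≤∼
  bottom-cover `¬∇x  _ = ≤-refl
  bottom-cover `∇¬x  _ = ≤-trans ∼▽≤∼ ▽-inflationary
  bottom-cover `x    ()
  bottom-cover `∇x   ()
  bottom-cover `¬∇¬x ()

  top-kill : ∀ k → lit₆ k s1 ≤₆ sB → lit k a ≤ ▽ ∼ a
  top-kill `¬x   _ = ▽-inflationary
  top-kill `∇¬x  _ = ≤-refl
  top-kill `¬∇x  _ = ≤-trans ∼▽≤∼ ▽-inflationary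
  top-kill `x    ()
  top-kill `∇x   ()
  top-kill `¬∇¬x ()

  top-cover : ∀ k → sN ≤₆ lit₆ k s1 → ∼ ▽ ∼ a ≤ lit k a
  top-cover `x    _ = ∼▽∼≤
  top-cover `¬∇¬x _ = ≤-refl
  top-cover `∇x   _ = ≤-trans ∼▽∼≤ ▽-inflationary
  top-cover `¬x   ()
  top-cover `¬∇x  ()
  top-cover `∇¬x  ()

  holds-on-bottom : Obstruction P Q s0 → HoldsOn (∼ ▽ a)
  holds-on-bottom (inj₁ (k , k∈P , h)) = killed k∈P (bottom-kill k h) (▽-disjoint a)
  holds-on-bottom (inj₂ (k , k∈Q , h)) = covered k∈Q (bottom-cover k h)

  holds-on-top : Obstruction P Q s1 → HoldsOn (∼ ▽ ∼ a)
  holds-on-top (inj₁ (k , k∈P , h)) = killed k∈P (top-kill k h) (▽-disjoint (∼ a))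
  holds-on-top (inj₂ (k , k∈Q , h)) = covered k∈Q (top-cover k h)

  middle : ∀ {u} → ∇₆ u ≡ s1 → ∇₆ (¬₆ u) ≡ s1 →
           Obstruction P Q u → HoldsOn (▽ a ∧ ▽ ∼ a) ⊎ PlainObstruction P Q u
  middle _ _ (inj₁ (`x   , k∈P , h)) = inj₂ (P∋x k∈P h)
  middle _ _ (inj₁ (`¬x  , k∈P , h)) = inj₂ (P∋¬x k∈P h)
  middle _ _ (inj₁ (`¬∇x , k∈P , _)) =
    inj₁ (killed k∈P ≤-refl (≤-trans (∧-monotonic ≤-refl (x∧y≤x _ _)) (∼▽-disjoint a)))
  middle _ _ (inj₁ (`¬∇¬x , k∈P , _)) =
    inj₁ (killed k∈P ≤-refl (≤-trans (∧-monotonic ≤-refl (x∧y≤y _ _)) (∼▽-disjoint (∼ a))))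
  middle ▽u _ (inj₁ (`∇x , _ , h)) = ⊥-elim (1≰B (subst (_≤₆ sB) ▽u h))
  middle _ ▽¬u (inj₁ (`∇¬x , _ , h)) = ⊥-elim (1≰B (subst (_≤₆ sB) ▽¬u h))
  middle _ _ (inj₂ (`x   , k∈Q , h)) = inj₂ (Q∋x k∈Q h)
  middle _ _ (inj₂ (`¬x  , k∈Q , h)) = inj₂ (Q∋¬x k∈Q h)
  middle _ _ (inj₂ (`∇x  , k∈Q , _)) = inj₁ (covered k∈Q (x∧y≤x _ _))
  middle _ _ (inj₂ (`∇¬x , k∈Q , _)) = inj₁ (covered k∈Q (x∧y≤y _ _))
  middle ▽u _ (inj₂ (`¬∇x , _ , h)) = ⊥-elim (N≰0 (subst (λ w → sN ≤₆ ¬₆ w) ▽u h))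
  middle _ ▽¬u (inj₂ (`¬∇¬x , _ , h)) = ⊥-elim (N≰0 (subst (λ w → sN ≤₆ ¬₆ w) ▽¬u h))

  holds-on-middle : (∀ u → Obstruction P Q u) → HoldsOn (▽ a ∧ ▽ ∼ a)
  holds-on-middle obstructed
    with middle refl refl (obstructed sN) | middle refl refl (obstructed sB)
       | middle refl refl (obstructed s⅔) | middle refl refl (obstructed s⅓)
  ... | inj₁ holds | _ | _ | _ = holds
  ... | _ | inj₁ holds | _ | _ = holds
  ... | _ | _ | inj₁ holds | _ = holds
  ... | _ | _ | _ | inj₁ holds = holds
  ... | inj₂ oN | inj₂ oB | inj₂ o⅔ | inj₂ o⅓ =
    let _ , k∈P , k∈Q = plain-shared oN oB o⅔ o⅓ in ≤-trans (x∧y≤x _ _) (shared k∈P k∈Q)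

  one-variable : ¬ ∃ (Separates P Q) → ⨅ (lits P a) ≤ ⨆ (lits Q a)
  one-variable inseparable =
    regions a (holds-on-bottom (obstructed s0)) (holds-on-top (obstructed s1)) (holds-on-middle obstructed)
    where
    obstructed : ∀ u → Obstruction P Q u
    obstructed u = obstruction (λ separates → inseparable (u , separates))

module _ (C D : Clause) where

  Separable : ℕ → Set
  Separable x = ∃ (Separates (kindsOn x C) (kindsOn x D))

  separable? : Decidable Separable
  separable? x = any₆? (separates? (kindsOn x C) (kindsOn x D))

  separator : ℕ → S6
  separator x with separable? x
  ... | yes (u , _) = u
  ... | no _        = s0

  separator-separates : ∀ {x} → Separable x → Separates (kindsOn x C) (kindsOn x D) (separator x)
  separator-separates {x} separable with separable? x
  ... | yes (_ , separates) = separates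
  ... | no inseparable      = contradiction separable inseparable

  separable-refutes : All (Separable ∘ proj₂) (C ++ D) → ¬ (∀ v → Six.conj C v ≤₆ Six.disj D v)
  separable-refutes separable valid = N≰B (begin
    sN                    ≤⟨ Six.⨅-greatest (λ l → Six.⟦ l ⟧ˡ separator) N≤ ⟩
    Six.conj C separator  ≤⟨ valid separator ⟩
    Six.disj D separator  ≤⟨ Six.⨆-least (λ l → Six.⟦ l ⟧ˡ separator) ≤B ⟩
    sB                    ∎)
    where
    open Six.≤-Reasoning
    N≤ : ∀ {l} → l ∈ C → sN ≤₆ Six.⟦ l ⟧ˡ separator
    N≤ {_ , _} l∈C = All.lookup (proj₁ (separator-separates (All.lookup separable (∈-++⁺ˡ l∈C))))
                                (∈-kindsOn⁺ l∈C)
    ≤B : ∀ {l} → l ∈ D → Six.⟦ l ⟧ˡ separator ≤₆ sB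
    ≤B {_ , _} l∈D = All.lookup (proj₂ (separator-separates (All.lookup separable (∈-++⁺ʳ C l∈D))))
                                (∈-kindsOn⁺ l∈D)

  module _ {ℓ} (A : ISA ℓ) where
    open Properties A

    inseparable-proves : ∀ {x} → ¬ Separable x → ∀ w → conj C w ≤ disj D w
    inseparable-proves {x} inseparable w = begin
      conj C w                        ≤⟨ conj≤kindsOn C x w ⟩
      ⨅ (lits (kindsOn x C) (w x))    ≤⟨ OneVariable.one-variable A _ _ (w x) inseparable ⟩
      ⨆ (lits (kindsOn x D) (w x))    ≤⟨ kindsOn≤disj D x w ⟩
      disj D w                        ∎
      where open ≤-Reasoning

    clause-completeness : (∀ v → Six.conj C v ≤₆ Six.disj D v) → ∀ w → conj C w ≤ disj D w
    clause-completeness valid with all? (separable? ∘ proj₂) (C ++ D)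
    ... | yes separable = contradiction valid (separable-refutes separable)
    ... | no ¬separable =
      let _ , _ , inseparable = find (¬All⇒Any¬ (separable? ∘ proj₂) (C ++ D) ¬separable)
      in inseparable-proves inseparable

-- Completeness of 𝕊₆

valid-clause-pairs : ∀ α β → (∀ v → eval 𝕊₆ α v ≤₆ eval 𝕊₆ β v) →
  ∀ {C D} → C ∈ dnf (nnf α) → D ∈ cnf (nnf β) → ∀ v → Six.conj C v ≤₆ Six.disj D v
valid-clause-pairs α β valid {C} {D} C∈ D∈ v = begin
  Six.conj C v               ≤⟨ Six.conj≤dnf v C∈ ⟩
  Six.⟦ dnf (nnf α) ⟧ᵈ v     ≡⟨ Six.dnf-form α v ⟨
  eval 𝕊₆ α v                ≤⟨ valid v ⟩
  eval 𝕊₆ β v                ≡⟨ Six.cnf-form β v ⟩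
  Six.⟦ cnf (nnf β) ⟧ᶜ v     ≤⟨ Six.cnf≤disj v D∈ ⟩
  Six.disj D v               ∎
  where open Six.≤-Reasoning

module _ {ℓ} (A : ISA ℓ) where
  open Properties A
  open ≤-Reasoning

  𝕊₆-complete : ∀ α β → (∀ v → eval 𝕊₆ α v ≤₆ eval 𝕊₆ β v) → ∀ w → eval raw α w ≤ eval raw β w
  𝕊₆-complete α β valid w = begin
    eval raw α w          ≡⟨ dnf-form α w ⟩
    ⟦ dnf (nnf α) ⟧ᵈ w    ≤⟨ dnf≤cnf w (λ {C} {D} C∈ D∈ →
                               clause-completeness C D A (valid-clause-pairs α β valid C∈ D∈) w) ⟩
    ⟦ cnf (nnf β) ⟧ᶜ w    ≡⟨ cnf-form β w ⟨
    eval raw β w          ∎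

valid-in-𝕊₆ : ∀ ℓ α β → α ⊨Six[ ℓ ] β → ∀ v → eval 𝕊₆ α v ≤₆ eval 𝕊₆ β v
valid-in-𝕊₆ ℓ α β consequence v = sym (cong lower (subst₂ (λ x y → ISA._⊓_ 𝕊₆↑ x y ≡ x)
  (eval-lift ℓ 𝕊₆ α v) (eval-lift ℓ 𝕊₆ β v)
  (consequence 𝕊₆↑ (lift ∘ v) _ (sym (Properties.≤-refl 𝕊₆↑)))))
  where
  𝕊₆↑ : ISA ℓ
  𝕊₆↑ = liftISA ℓ 𝕊₆-ISA

mainTheorem16 : (ℓ : Level) (Γ Δ : List Fm) → ValidSeq Γ Δ ⇔ (⋀ Γ ⊨Six[ ℓ ] ⋁ Δ)
mainTheorem16 ℓ Γ Δ = mk⇔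
  (λ valid A v a a≤Γ → sym (Properties.≤-trans A (sym a≤Γ)
    (𝕊₆-complete A (⋀ Γ) (⋁ Δ) (λ u → sym (valid u)) v)))
  (λ consequence v → sym (valid-in-𝕊₆ ℓ (⋀ Γ) (⋁ Δ) consequence v))
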